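{- Let $k>4$ and let $G$ be a downward $k$-cycle. Then for every pebbling assignment $(S_G)$ on $G$, $G$ is not isomorphic (as a directed graph) to $[S_G]$.
   Context: A downward $k$-cycle is an oriented graph on $k$ vertices whose underlying undirected graph is a cycle, with exactly one vertex of in-degree $0$ (the top) and exactly one vertex of out-degree $0$ (the bottom); equivalently it is the union of two internally vertex-disjoint directed paths from the top to the bottom. A pebbling assignment $(S_G)$ assigns a nonnegative integer number of pebbles to each vertex. A pebbling move along an edge $(v,w)$ (allowed when $v$ has at least two pebbles) removes two pebbles from $v$ and adds one pebble to $w$. The assignment graph $[S_G]$ is the directed graph whose vertices are all assignments obtainable from $(S_G)$ by finite sequences of pebbling moves (including $(S_G)$ itself), with a directed edge from $A$ to $B$ whenever $B$ is obtained from $A$ by a single pebbling move. -}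

module Defs where

open import Data.Nat using (ℕ; zero; suc; _≤_; _∸_)
open import Data.Fin using (Fin; toℕ)
open import Data.Vec using (Vec; lookup; _[_]%=_)
open import Data.Product using (Σ; ∃; ∃-syntax; _×_)
open import Data.Sum using (_⊎_)
open import Relation.Nullary using (¬_)
open import Relation.Binary.PropositionalEquality using (_≡_)
open import Relation.Binary.Construct.Closure.ReflexiveTransitive using (Star)
open import Function.Bundles using (_⇔_; _↔_; Inverse)

Digraph : ℕ → Set₁
Digraph k = Fin k → Fin k → Set

CycAdj : (k : ℕ) → Fin k → Fin k → Set
CycAdj k i j = (suc (toℕ i) ≡ toℕ j) ⊎ (suc (toℕ i) ≡ k × toℕ j ≡ 0)

Oriented : {k : ℕ} → Digraph k → Set
Oriented E = ∀ u v → E u v → ¬ E v u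

-- The underlying undirected graph is a k-cycle: some relabelling π of the
-- vertices makes undirected adjacency coincide with cycle adjacency.
UnderlyingCycle : {k : ℕ} → Digraph k → Set
UnderlyingCycle {k} E =
  Σ (Fin k ↔ Fin k) λ π → ∀ u v →
    (E u v ⊎ E v u) ⇔
      (CycAdj k (Inverse.to π u) (Inverse.to π v) ⊎ CycAdj k (Inverse.to π v) (Inverse.to π u))

InDegZero : {k : ℕ} → Digraph k → Fin k → Set
InDegZero E v = ∀ u → ¬ E u v

OutDegZero : {k : ℕ} → Digraph k → Fin k → Set
OutDegZero E v = ∀ w → ¬ E v w

ExactlyOne : {k : ℕ} → (Fin k → Set) → Set
ExactlyOne P = ∃[ t ] (P t × ∀ t′ → P t′ → t′ ≡ t)

DownwardCycle : {k : ℕ} → Digraph k → Set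
DownwardCycle E =
  Oriented E × UnderlyingCycle E × ExactlyOne (InDegZero E) × ExactlyOne (OutDegZero E)

Assignment : ℕ → Set
Assignment k = Vec ℕ k

Move : {k : ℕ} → Digraph k → Assignment k → Assignment k → Set
Move E A B = ∃[ v ] ∃[ w ] (E v w × 2 ≤ lookup A v ×
               B ≡ ((A [ v ]%= (λ n → n ∸ 2)) [ w ]%= suc))

Reachable : {k : ℕ} → Digraph k → Assignment k → Assignment k → Set
Reachable E = Star (Move E)

-- G ≅ [S]: a bijection f from the vertices of G onto the vertex set of the
-- assignment graph [S] (the assignments reachable from S) such that
-- E u v holds iff there is an edge f u → f v in [S].
IsoToAssignmentGraph : {k : ℕ} → Digraph k → Assignment k → Set
IsoToAssignmentGraph {k} E S =
  Σ (Fin k → Assignment k) λ f →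
    (∀ u → Reachable E S (f u)) ×
    (∀ u v → f u ≡ f v → u ≡ v) ×
    (∀ A → Reachable E S A → ∃[ u ] f u ≡ A) ×
    (∀ u v → E u v ⇔ Move E (f u) (f v))

-- Let f : G ≅ [S]. Every move loses a pebble, so f⁻¹(S) is a source of G; it has two out-neighbours,
-- the images of two moves v₁ → w₁ and v₂ → w₂ out of S, and for the same reason every vertex of G
-- flows down to the sink b. If each of the two moves stays available after the other (v₁ ≠ v₂, or
-- v₁ = v₂ holds at least four pebbles) they commute, so G contains a diamond u → a₁, a₂ → c; as c is
-- then the sink and all of G flows into it, G has at most four vertices. Otherwise v₁ = v₂ = v holds
-- two or three pebbles and the moves go to w₁ ≠ w₂. Then v is a source whose successor w (one of the
-- wᵢ that is not b) is fed by v alone; after either move v can never fire again, so w only ever loses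
-- pebbles in pairs. Both branches reach f b, yet they start with counts of different parity on w.

module Submission where

open import Defs
open import Data.Nat using (ℕ; suc; _+_; _*_; _∸_; _≤_; _<_; z≤n; s≤s; _≤?_)
open import Data.Nat.Properties
open import Data.Fin using (Fin; toℕ; fromℕ; fromℕ<; inject₁) renaming (zero to fzero; suc to fsuc)
open import Data.Fin.Properties using (toℕ-injective; toℕ<n; toℕ-fromℕ; toℕ-fromℕ<; toℕ-inject₁; injective⇒≤)
  renaming (_≟_ to _≟ᶠ_)
open import Data.Vec using (Vec; _∷_; lookup; _[_]%=_; sum)
open import Data.Vec.Properties using (lookup∘updateAt; lookup∘updateAt′; tabulate∘lookup; tabulate-cong)
open import Data.Product using (∃; ∃₂; ∃-syntax; _×_; _,_; proj₁; proj₂)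
open import Data.Sum using (_⊎_; inj₁; inj₂)
open import Data.Empty using (⊥; ⊥-elim)
open import Relation.Nullary using (¬_; yes; no)
open import Relation.Binary.PropositionalEquality
open import Relation.Binary.Construct.Closure.ReflexiveTransitive using (Star; ε; _◅_; _◅◅_; gmap)
open import Function.Bundles using (_⇔_; Inverse; Equivalence)
open import Function.Base using (case_of_)
open import Algebra.Properties.CommutativeSemigroup +-commutativeSemigroup using (xy∙z≈xz∙y)

move : ∀ {n} → Vec ℕ n → Fin n → Fin n → Vec ℕ n
move A v w = (A [ v ]%= (_∸ 2)) [ w ]%= suc

module _ {n} (A : Vec ℕ n) {v w : Fin n} (v≢w : v ≢ w) where

  lookup-move-source : lookup (move A v w) v ≡ lookup A v ∸ 2
  lookup-move-source = trans (lookup∘updateAt′ v w v≢w (A [ v ]%= (_∸ 2))) (lookup∘updateAt v A)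

  lookup-move-target : lookup (move A v w) w ≡ suc (lookup A w)
  lookup-move-target = trans (lookup∘updateAt w (A [ v ]%= (_∸ 2))) (cong suc (lookup∘updateAt′ w v (≢-sym v≢w) A))

  lookup-move-other : ∀ {j} → v ≢ j → w ≢ j → lookup (move A v w) j ≡ lookup A j
  lookup-move-other {j} v≢j w≢j =
    trans (lookup∘updateAt′ j w (≢-sym w≢j) (A [ v ]%= (_∸ 2))) (lookup∘updateAt′ j v (≢-sym v≢j) A)

δ : ∀ {n} → Fin n → Fin n → ℕ
δ i j with i ≟ᶠ j
... | yes _ = 1
... | no  _ = 0

lookup-move : ∀ {n} (A : Vec ℕ n) {v w : Fin n} → v ≢ w → 2 ≤ lookup A v →
              ∀ j → lookup (move A v w) j + 2 * δ v j ≡ lookup A j + δ w j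
lookup-move A {v} {w} v≢w 2≤Av j with v ≟ᶠ j | w ≟ᶠ j
... | yes refl | yes refl = ⊥-elim (v≢w refl)
... | yes refl | no  _    = begin
  lookup (move A v w) v + 2  ≡⟨ cong (_+ 2) (lookup-move-source A v≢w) ⟩
  lookup A v ∸ 2 + 2         ≡⟨ m∸n+n≡m 2≤Av ⟩
  lookup A v                 ≡⟨ +-identityʳ _ ⟨
  lookup A v + 0             ∎
  where open ≡-Reasoning
... | no  _    | yes refl = begin
  lookup (move A v w) w + 0  ≡⟨ +-identityʳ _ ⟩
  lookup (move A v w) w      ≡⟨ lookup-move-target A v≢w ⟩
  suc (lookup A w)           ≡⟨ +-comm 1 _ ⟩
  lookup A w + 1             ∎
  where open ≡-Reasoning
... | no v≢j   | no w≢j   = cong (_+ 0) (lookup-move-other A v≢w v≢j w≢j)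

lookup-move-move : ∀ {n} (A : Vec ℕ n) {v₁ w₁ v₂ w₂ : Fin n} → v₁ ≢ w₁ → v₂ ≢ w₂ →
  2 ≤ lookup A v₁ → 2 ≤ lookup (move A v₁ w₁) v₂ → ∀ j →
  lookup (move (move A v₁ w₁) v₂ w₂) j + (2 * δ v₂ j + 2 * δ v₁ j) ≡ lookup A j + (δ w₁ j + δ w₂ j)
lookup-move-move A {v₁} {w₁} {v₂} {w₂} v₁≢w₁ v₂≢w₂ 2≤A₁ 2≤A₂ j = begin
  lookup (move A₁ v₂ w₂) j + (2 * δ v₂ j + 2 * δ v₁ j)  ≡⟨ +-assoc (lookup (move A₁ v₂ w₂) j) _ _ ⟨
  lookup (move A₁ v₂ w₂) j + 2 * δ v₂ j + 2 * δ v₁ j    ≡⟨ cong (_+ 2 * δ v₁ j) (lookup-move A₁ v₂≢w₂ 2≤A₂ j) ⟩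
  lookup A₁ j + δ w₂ j + 2 * δ v₁ j                     ≡⟨ xy∙z≈xz∙y (lookup A₁ j) _ _ ⟩
  lookup A₁ j + 2 * δ v₁ j + δ w₂ j                     ≡⟨ cong (_+ δ w₂ j) (lookup-move A v₁≢w₁ 2≤A₁ j) ⟩
  lookup A j + δ w₁ j + δ w₂ j                          ≡⟨ +-assoc (lookup A j) _ _ ⟩
  lookup A j + (δ w₁ j + δ w₂ j)                        ∎
  where open ≡-Reasoning
        A₁ = move A v₁ w₁

vec-ext : ∀ {a n} {B : Set a} {xs ys : Vec B n} → (∀ i → lookup xs i ≡ lookup ys i) → xs ≡ ys
vec-ext {xs = xs} {ys} eq = trans (sym (tabulate∘lookup xs)) (trans (tabulate-cong eq) (tabulate∘lookup ys))

moves-commute : ∀ {n} (A : Vec ℕ n) {v₁ w₁ v₂ w₂ : Fin n} → v₁ ≢ w₁ → v₂ ≢ w₂ →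
  2 ≤ lookup A v₁ → 2 ≤ lookup A v₂ → 2 ≤ lookup (move A v₁ w₁) v₂ → 2 ≤ lookup (move A v₂ w₂) v₁ →
  move (move A v₁ w₁) v₂ w₂ ≡ move (move A v₂ w₂) v₁ w₁
moves-commute A {v₁} {w₁} {v₂} {w₂} v₁≢w₁ v₂≢w₂ 2≤Av₁ 2≤Av₂ 2≤A₁v₂ 2≤A₂v₁ = vec-ext λ j →
  let B₁ = lookup (move (move A v₁ w₁) v₂ w₂) j
      B₂ = lookup (move (move A v₂ w₂) v₁ w₁) j
  in +-cancelʳ-≡ _ B₁ B₂ (begin
    B₁ + (2 * δ v₂ j + 2 * δ v₁ j)  ≡⟨ lookup-move-move A v₁≢w₁ v₂≢w₂ 2≤Av₁ 2≤A₁v₂ j ⟩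
    lookup A j + (δ w₁ j + δ w₂ j)  ≡⟨ cong (lookup A j +_) (+-comm (δ w₁ j) _) ⟩
    lookup A j + (δ w₂ j + δ w₁ j)  ≡⟨ lookup-move-move A v₂≢w₂ v₁≢w₁ 2≤Av₂ 2≤A₂v₁ j ⟨
    B₂ + (2 * δ v₁ j + 2 * δ v₂ j)  ≡⟨ cong (B₂ +_) (+-comm (2 * δ v₁ j) _) ⟩
    B₂ + (2 * δ v₂ j + 2 * δ v₁ j)  ∎)
  where open ≡-Reasoning

move-keeps-other-enabled : ∀ {n} (A : Vec ℕ n) {v w u : Fin n} → v ≢ w → v ≢ u →
                           2 ≤ lookup A u → 2 ≤ lookup (move A v w) u
move-keeps-other-enabled A {v} {w} {u} v≢w v≢u 2≤Au with w ≟ᶠ u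
... | yes refl = ≤-trans 2≤Au (≤-trans (n≤1+n _) (≤-reflexive (sym (lookup-move-target A v≢w))))
... | no  w≢u  = ≤-trans 2≤Au (≤-reflexive (sym (lookup-move-other A v≢w v≢u w≢u)))

move-keeps-rich-source-enabled : ∀ {n} (A : Vec ℕ n) {v w : Fin n} → v ≢ w →
                                 4 ≤ lookup A v → 2 ≤ lookup (move A v w) v
move-keeps-rich-source-enabled A v≢w 4≤Av = ≤-trans (∸-monoˡ-≤ 2 4≤Av) (≤-reflexive (sym (lookup-move-source A v≢w)))

sum-increment : ∀ {n} (xs : Vec ℕ n) i → sum (xs [ i ]%= suc) ≡ suc (sum xs)
sum-increment (x ∷ xs) fzero    = refl
sum-increment (x ∷ xs) (fsuc i) = trans (cong (x +_) (sum-increment xs i)) (+-suc x (sum xs))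

sum-decrease : ∀ {n} (xs : Vec ℕ n) i {m} → m ≤ lookup xs i → sum (xs [ i ]%= (_∸ m)) + m ≡ sum xs
sum-decrease (x ∷ xs) fzero    {m} m≤x = trans (xy∙z≈xz∙y (x ∸ m) (sum xs) m) (cong (_+ sum xs) (m∸n+n≡m m≤x))
sum-decrease (x ∷ xs) (fsuc i) m≤xs = trans (+-assoc x _ _) (cong (x +_) (sum-decrease xs i m≤xs))

sum-move : ∀ {n} (A : Vec ℕ n) v w → 2 ≤ lookup A v → suc (sum (move A v w)) ≡ sum A
sum-move A v w 2≤Av = begin
  suc (sum (move A v w))       ≡⟨ cong suc (sum-increment (A [ v ]%= (_∸ 2)) w) ⟩
  2 + sum (A [ v ]%= (_∸ 2))   ≡⟨ +-comm 2 _ ⟩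
  sum (A [ v ]%= (_∸ 2)) + 2   ≡⟨ sum-decrease A v 2≤Av ⟩
  sum A                        ∎
  where open ≡-Reasoning

cycAdj-succ : ∀ {n} (i : Fin n) → ∃[ j ] CycAdj n i j
cycAdj-succ {suc m} i with suc (toℕ i) <? suc m
... | yes i+1<n  = fromℕ< i+1<n , inj₁ (sym (toℕ-fromℕ< i+1<n))
... | no  i+1≮n = fzero , inj₂ (≤-antisym (toℕ<n i) (≮⇒≥ i+1≮n) , refl)

cycAdj-pred : ∀ {n} (j : Fin n) → ∃[ i ] CycAdj n i j
cycAdj-pred {suc m} fzero    = fromℕ m , inj₂ (cong suc (toℕ-fromℕ m) , refl)
cycAdj-pred {suc m} (fsuc j) = inject₁ j , inj₁ (cong suc (toℕ-inject₁ j))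

cycAdj-functional : ∀ {n} {i j j′ : Fin n} → CycAdj n i j → CycAdj n i j′ → j ≡ j′
cycAdj-functional (inj₁ i+1≡j) (inj₁ i+1≡j′) = toℕ-injective (trans (sym i+1≡j) i+1≡j′)
cycAdj-functional {j = j} (inj₁ i+1≡j) (inj₂ (i+1≡n , _)) = ⊥-elim (<-irrefl (trans (sym i+1≡j) i+1≡n) (toℕ<n j))
cycAdj-functional {j′ = j′} (inj₂ (i+1≡n , _)) (inj₁ i+1≡j′) = ⊥-elim (<-irrefl (trans (sym i+1≡j′) i+1≡n) (toℕ<n j′))
cycAdj-functional (inj₂ (_ , j≡0)) (inj₂ (_ , j′≡0)) = toℕ-injective (trans j≡0 (sym j′≡0))

cycAdj-injective : ∀ {n} {i i′ j : Fin n} → CycAdj n i j → CycAdj n i′ j → i ≡ i′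
cycAdj-injective (inj₁ i+1≡j) (inj₁ i′+1≡j) = toℕ-injective (suc-injective (trans i+1≡j (sym i′+1≡j)))
cycAdj-injective (inj₁ i+1≡j) (inj₂ (_ , j≡0)) with trans i+1≡j j≡0
... | ()
cycAdj-injective (inj₂ (_ , j≡0)) (inj₁ i′+1≡j) with trans i′+1≡j j≡0
... | ()
cycAdj-injective (inj₂ (i+1≡n , _)) (inj₂ (i′+1≡n , _)) = toℕ-injective (suc-injective (trans i+1≡n (sym i′+1≡n)))

cycAdj-succ≢pred : ∀ {n} → 2 < n → {i s p : Fin n} → CycAdj n i s → CycAdj n p i → s ≢ p
cycAdj-succ≢pred _ (inj₁ i+1≡s) (inj₁ s+1≡i) refl = 1+n≰n (≤-trans (n≤1+n _) (≤-reflexive (trans (cong suc i+1≡s) s+1≡i)))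
cycAdj-succ≢pred 2<n (inj₁ i+1≡s) (inj₂ (s+1≡n , i≡0)) refl =
  <-irrefl (trans (cong (λ m → suc (suc m)) (sym i≡0)) (trans (cong suc i+1≡s) s+1≡n)) 2<n
cycAdj-succ≢pred 2<n (inj₂ (i+1≡n , s≡0)) (inj₁ s+1≡i) refl =
  <-irrefl (trans (cong (λ m → suc (suc m)) (sym s≡0)) (trans (cong suc s+1≡i) i+1≡n)) 2<n
cycAdj-succ≢pred 2<n (inj₂ (i+1≡n , _)) (inj₂ (_ , i≡0)) refl with subst (2 <_) (trans (sym i+1≡n) (cong suc i≡0)) 2<n
... | s≤s ()

module CycleNeighbourhoods {k : ℕ} (2<k : 2 < k) {E : Digraph k} (oriented : Oriented E) (cycle : UnderlyingCycle E) where

  Adjacent : Fin k → Fin k → Set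
  Adjacent u x = E u x ⊎ E x u

  private
    π = proj₁ cycle
    open Inverse π using (to; from; strictlyInverseˡ; strictlyInverseʳ)

  record Neighbours (u : Fin k) : Set where
    field
      left right   : Fin k
      left≢right   : left ≢ right
      adjacent-left  : Adjacent u left
      adjacent-right : Adjacent u right
      only         : ∀ x → Adjacent u x → x ≡ left ⊎ x ≡ right

  neighbours : ∀ u → Neighbours u
  neighbours u = record
    { left = from s ; right = from p
    ; left≢right = λ s≡p → cycAdj-succ≢pred 2<k us pu
        (trans (sym (strictlyInverseˡ s)) (trans (cong to s≡p) (strictlyInverseˡ p)))
    ; adjacent-left = cycAdj⇒adjacent (from s) (inj₁ (subst (CycAdj k (to u)) (sym (strictlyInverseˡ s)) us))
    ; adjacent-right = cycAdj⇒adjacent (from p) (inj₂ (subst (λ z → CycAdj k z (to u)) (sym (strictlyInverseˡ p)) pu))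
    ; only = only
    }
    where
    s = proj₁ (cycAdj-succ (to u))
    us = proj₂ (cycAdj-succ (to u))
    p = proj₁ (cycAdj-pred (to u))
    pu = proj₂ (cycAdj-pred (to u))
    cycAdj⇒adjacent : ∀ x → CycAdj k (to u) (to x) ⊎ CycAdj k (to x) (to u) → Adjacent u x
    cycAdj⇒adjacent x = Equivalence.from (proj₂ cycle u x)
    only : ∀ x → Adjacent u x → x ≡ from s ⊎ x ≡ from p
    only x ux with Equivalence.to (proj₂ cycle u x) ux
    ... | inj₁ u→x = inj₁ (trans (sym (strictlyInverseʳ x)) (cong from (cycAdj-functional u→x us)))
    ... | inj₂ x→u = inj₂ (trans (sym (strictlyInverseʳ x)) (cong from (cycAdj-injective x→u pu)))

  module Nbrs u = Neighbours (neighbours u)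

  adjacent-either : ∀ {u x y z} → Adjacent u x → Adjacent u y → x ≢ y → Adjacent u z → z ≡ x ⊎ z ≡ y
  adjacent-either {u} {x} {y} {z} ux uy x≢y uz with Nbrs.only u x ux | Nbrs.only u y uy | Nbrs.only u z uz
  ... | inj₁ x≡l | inj₁ y≡l | _        = ⊥-elim (x≢y (trans x≡l (sym y≡l)))
  ... | inj₂ x≡r | inj₂ y≡r | _        = ⊥-elim (x≢y (trans x≡r (sym y≡r)))
  ... | inj₁ x≡l | inj₂ _   | inj₁ z≡l = inj₁ (trans z≡l (sym x≡l))
  ... | inj₁ _   | inj₂ y≡r | inj₂ z≡r = inj₂ (trans z≡r (sym y≡r))
  ... | inj₂ _   | inj₁ y≡l | inj₁ z≡l = inj₂ (trans z≡l (sym y≡l))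
  ... | inj₂ x≡r | inj₁ _   | inj₂ z≡r = inj₁ (trans z≡r (sym x≡r))

  out-edge-or-sink : ∀ u → (∃[ y ] E u y) ⊎ OutDegZero E u
  out-edge-or-sink u with Nbrs.adjacent-left u | Nbrs.adjacent-right u
  ... | inj₁ u→l | _        = inj₁ (_ , u→l)
  ... | inj₂ _   | inj₁ u→r = inj₁ (_ , u→r)
  ... | inj₂ l→u | inj₂ r→u = inj₂ λ y u→y → case Nbrs.only u y (inj₁ u→y) of λ
        { (inj₁ refl) → oriented _ _ l→u u→y
        ; (inj₂ refl) → oriented _ _ r→u u→y }

  source⇒two-out : ∀ {u} → InDegZero E u → ∃₂ λ a₁ a₂ → a₁ ≢ a₂ × E u a₁ × E u a₂
  source⇒two-out {u} source with Nbrs.adjacent-left u | Nbrs.adjacent-right u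
  ... | inj₁ u→l | inj₁ u→r = _ , _ , Nbrs.left≢right u , u→l , u→r
  ... | inj₂ l→u | _        = ⊥-elim (source _ l→u)
  ... | inj₁ _   | inj₂ r→u = ⊥-elim (source _ r→u)

  two-out⇒source : ∀ {u x y} → E u x → E u y → x ≢ y → InDegZero E u
  two-out⇒source u→x u→y x≢y z z→u with adjacent-either (inj₁ u→x) (inj₁ u→y) x≢y (inj₂ z→u)
  ... | inj₁ refl = oriented _ _ u→x z→u
  ... | inj₂ refl = oriented _ _ u→y z→u

  two-in⇒sink : ∀ {u x y} → E x u → E y u → x ≢ y → OutDegZero E u
  two-in⇒sink x→u y→u x≢y z u→z with adjacent-either (inj₂ x→u) (inj₂ y→u) x≢y (inj₁ u→z)
  ... | inj₁ refl = oriented _ _ x→u u→z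
  ... | inj₂ refl = oriented _ _ y→u u→z

  unique-in-neighbour : ∀ {v w y} → E v w → E w y → ∀ u → E u w → u ≡ v
  unique-in-neighbour v→w w→y u u→w
    with adjacent-either (inj₂ v→w) (inj₁ w→y) (λ { refl → oriented _ _ v→w w→y }) (inj₂ u→w)
  ... | inj₁ u≡v  = u≡v
  ... | inj₂ refl = ⊥-elim (oriented _ _ w→y u→w)

  diamond⇒≤4 : ∀ {u a₁ a₂ c} → (∀ x → Star E x c) →
               E u a₁ → E u a₂ → a₁ ≢ a₂ → E a₁ c → E a₂ c → k ≤ 4
  diamond⇒≤4 {u} {a₁} {a₂} {c} reach-c u→a₁ u→a₂ a₁≢a₂ a₁→c a₂→c =
    injective⇒≤ {f = index} λ {x} {y} ix≡iy →
      trans (sym (proj₂ (covered x))) (trans (cong corner ix≡iy) (proj₂ (covered y)))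
    where
    corner : Fin 4 → Fin k
    corner fzero                      = u
    corner (fsuc fzero)               = a₁
    corner (fsuc (fsuc fzero))        = a₂
    corner (fsuc (fsuc (fsuc fzero))) = c

    IsCorner : Fin k → Set
    IsCorner x = ∃[ i ] corner i ≡ x

    predecessor-corner : ∀ {x y} → E x y → IsCorner y → IsCorner x
    predecessor-corner x→u  (fzero , refl) = ⊥-elim (two-out⇒source u→a₁ u→a₂ a₁≢a₂ _ x→u)
    predecessor-corner x→a₁ (fsuc fzero , refl) = fzero , sym (unique-in-neighbour u→a₁ a₁→c _ x→a₁)
    predecessor-corner x→a₂ (fsuc (fsuc fzero) , refl) = fzero , sym (unique-in-neighbour u→a₂ a₂→c _ x→a₂)
    predecessor-corner x→c  (fsuc (fsuc (fsuc fzero)) , refl)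
      with adjacent-either (inj₂ a₁→c) (inj₂ a₂→c) a₁≢a₂ (inj₂ x→c)
    ... | inj₁ x≡a₁ = fsuc fzero , sym x≡a₁
    ... | inj₂ x≡a₂ = fsuc (fsuc fzero) , sym x≡a₂

    ancestor-corner : ∀ {x y} → Star E x y → IsCorner y → IsCorner x
    ancestor-corner ε           y-corner = y-corner
    ancestor-corner (x→z ◅ z⇝y) y-corner = predecessor-corner x→z (ancestor-corner z⇝y y-corner)

    covered : ∀ x → IsCorner x
    covered x = ancestor-corner (reach-c x) (fsuc (fsuc (fsuc fzero)) , refl)

    index : Fin k → Fin 4
    index x = proj₁ (covered x)

Oriented⇒edge⇒≢ : ∀ {k} {E : Digraph k} → Oriented E → ∀ {u v} → E u v → u ≢ v
Oriented⇒edge⇒≢ oriented u→v refl = oriented _ _ u→v u→v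

parity-clash : ∀ {x y m m′} → suc x ≡ y + 2 * m → x ≡ y + 2 * m′ → ⊥
parity-clash {x} {y} {m} {m′} x+1≡ x≡ = even≢odd m m′ (+-cancelˡ-≡ y _ _ (begin
  y + 2 * m          ≡⟨ x+1≡ ⟨
  suc x              ≡⟨ cong suc x≡ ⟩
  suc (y + 2 * m′)   ≡⟨ +-suc y _ ⟨
  y + suc (2 * m′)   ∎))
  where open ≡-Reasoning

module _ {k : ℕ} {E : Digraph k} where

  sum-Move : ∀ {A B} → Move E A B → suc (sum B) ≡ sum A
  sum-Move {A} (v , w , _ , 2≤Av , refl) = sum-move A v w 2≤Av

  sum-Reachable : ∀ {A B} → Reachable E A B → sum B ≤ sum A
  sum-Reachable ε           = ≤-refl
  sum-Reachable (A→C ◅ C⇝B) = ≤-trans (sum-Reachable C⇝B) (≤-trans (n≤1+n _) (≤-reflexive (sum-Move A→C)))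

module _ {k : ℕ} {E : Digraph k} (oriented : Oriented E) {v w : Fin k}
         (v-source : InDegZero E v) (fed-by-v : ∀ u → E u w → u ≡ v) where

  poor-source-Move : ∀ {X Y} → lookup X v ≤ 1 → Move E X Y →
                     lookup Y v ≡ lookup X v × ∃[ m ] lookup X w ≡ lookup Y w + 2 * m
  poor-source-Move {X} Xv≤1 (p , q , p→q , 2≤Xp , refl) = lookup-move-other X p≢q p≢v q≢v , w-loss
    where
    p≢q = Oriented⇒edge⇒≢ oriented p→q
    p≢v : p ≢ v
    p≢v refl with ≤-trans 2≤Xp Xv≤1
    ... | s≤s ()
    q≢v : q ≢ v
    q≢v refl = v-source p p→q
    q≢w : q ≢ w
    q≢w refl = p≢v (fed-by-v p p→q)
    w-loss : ∃[ m ] lookup X w ≡ lookup (move X p q) w + 2 * m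
    w-loss with p ≟ᶠ w
    ... | yes refl = 1 , sym (trans (cong (_+ 2) (lookup-move-source X p≢q)) (m∸n+n≡m 2≤Xp))
    ... | no  p≢w  = 0 , trans (sym (lookup-move-other X p≢q p≢w q≢w)) (sym (+-identityʳ _))

  poor-source-Reachable : ∀ {X Z} → lookup X v ≤ 1 → Reachable E X Z → ∃[ m ] lookup X w ≡ lookup Z w + 2 * m
  poor-source-Reachable Xv≤1 ε = 0 , sym (+-identityʳ _)
  poor-source-Reachable {X} {Z} Xv≤1 (_◅_ {j = Y} X→Y Y⇝Z) with poor-source-Move Xv≤1 X→Y
  ... | Yv≡Xv , m , Xw≡Yw+2m with poor-source-Reachable (subst (_≤ 1) (sym Yv≡Xv) Xv≤1) Y⇝Z
  ...   | n , Yw≡Zw+2n = n + m , (begin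
    lookup X w                  ≡⟨ Xw≡Yw+2m ⟩
    lookup Y w + 2 * m          ≡⟨ cong (_+ 2 * m) Yw≡Zw+2n ⟩
    lookup Z w + 2 * n + 2 * m  ≡⟨ +-assoc (lookup Z w) _ _ ⟩
    lookup Z w + (2 * n + 2 * m) ≡⟨ cong (lookup Z w +_) (*-distribˡ-+ 2 n m) ⟨
    lookup Z w + 2 * (n + m)    ∎)
    where open ≡-Reasoning

module AssignmentGraphIso {k : ℕ} (4<k : 4 < k) {E : Digraph k} (oriented : Oriented E) (cycle : UnderlyingCycle E)
         {b : Fin k} (b-unique : ∀ u → OutDegZero E u → u ≡ b) {S : Assignment k}
         (f : Fin k → Assignment k) (f-reachable : ∀ u → Reachable E S (f u))
         (f-injective : ∀ u v → f u ≡ f v → u ≡ v) (f-surjective : ∀ A → Reachable E S A → ∃[ u ] f u ≡ A)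
         (edge⇔Move : ∀ u v → E u v ⇔ Move E (f u) (f v)) where

  open CycleNeighbourhoods (≤-trans (s≤s (s≤s (s≤s z≤n))) (<⇒≤ 4<k)) oriented cycle

  edge⇒≢ : ∀ {u v} → E u v → u ≢ v
  edge⇒≢ = Oriented⇒edge⇒≢ oriented

  edge⇒Move : ∀ {u v} → E u v → Move E (f u) (f v)
  edge⇒Move {u} {v} = Equivalence.to (edge⇔Move u v)

  Move⇒edge : ∀ u {A} → Move E (f u) A → ∃[ v ] f v ≡ A × E u v
  Move⇒edge u {A} fu→A with f-surjective A (f-reachable u ◅◅ (fu→A ◅ ε))
  ... | v , refl = v , refl , Equivalence.from (edge⇔Move u v) fu→A

  s₀ : Fin k
  s₀ = proj₁ (f-surjective S ε)

  f-s₀ : f s₀ ≡ S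
  f-s₀ = proj₂ (f-surjective S ε)

  s₀-source : InDegZero E s₀
  s₀-source u u→s₀ = 1+n≰n (begin
    suc (sum (f s₀))  ≡⟨ sum-Move (edge⇒Move u→s₀) ⟩
    sum (f u)         ≤⟨ sum-Reachable (f-reachable u) ⟩
    sum S             ≡⟨ cong sum f-s₀ ⟨
    sum (f s₀)        ∎)
    where open ≤-Reasoning

  Move-from-S : ∀ {a} → E s₀ a → Move E S (f a)
  Move-from-S {a} s₀→a = subst (λ X → Move E X (f a)) f-s₀ (edge⇒Move s₀→a)

  reaches-bottom : ∀ x → Star E x b
  reaches-bottom x = go (suc (sum (f x))) x ≤-refl
    where
    go : ∀ n x → sum (f x) < n → Star E x b
    go (suc n) x fx<1+n with out-edge-or-sink x
    ... | inj₁ (y , x→y) = x→y ◅ go n y (≤-trans (≤-reflexive (sum-Move (edge⇒Move x→y))) (≤-pred fx<1+n))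
    ... | inj₂ x-sink    = subst (Star E x) (b-unique x x-sink) ε

  common-successor⇒≤4 : ∀ {u a₁ a₂ A₁ A₂ C} → E u a₁ → E u a₂ → a₁ ≢ a₂ → f a₁ ≡ A₁ → f a₂ ≡ A₂ →
                        Move E A₁ C → Move E A₂ C → k ≤ 4
  common-successor⇒≤4 {a₂ = a₂} u→a₁ u→a₂ a₁≢a₂ refl refl a₁⇒C a₂⇒C with Move⇒edge _ a₁⇒C
  ... | c , refl , a₁→c = diamond⇒≤4 reaches-c u→a₁ u→a₂ a₁≢a₂ a₁→c a₂→c
    where
    a₂→c : E a₂ c
    a₂→c = Equivalence.from (edge⇔Move a₂ c) a₂⇒C
    reaches-c : ∀ x → Star E x c
    reaches-c x = subst (Star E x) (sym (b-unique c (two-in⇒sink a₁→c a₂→c a₁≢a₂))) (reaches-bottom x)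

  commuting-moves⇒≤4 : ∀ {u a₁ a₂ v₁ w₁ v₂ w₂} → E u a₁ → E u a₂ → a₁ ≢ a₂ →
    E v₁ w₁ → E v₂ w₂ → f a₁ ≡ move S v₁ w₁ → f a₂ ≡ move S v₂ w₂ →
    2 ≤ lookup S v₁ → 2 ≤ lookup S v₂ → 2 ≤ lookup (move S v₁ w₁) v₂ → 2 ≤ lookup (move S v₂ w₂) v₁ → k ≤ 4
  commuting-moves⇒≤4 {v₁ = v₁} {w₁} {v₂} {w₂} u→a₁ u→a₂ a₁≢a₂ v₁→w₁ v₂→w₂ fa₁ fa₂
                     2≤Sv₁ 2≤Sv₂ 2≤S₁v₂ 2≤S₂v₁ =
    common-successor⇒≤4 u→a₁ u→a₂ a₁≢a₂ fa₁ fa₂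
      (v₂ , w₂ , v₂→w₂ , 2≤S₁v₂ , refl)
      (v₁ , w₁ , v₁→w₁ , 2≤S₂v₁ ,
       moves-commute S (edge⇒≢ v₁→w₁) (edge⇒≢ v₂→w₂) 2≤Sv₁ 2≤Sv₂ 2≤S₁v₂ 2≤S₂v₁)

  drained-into-bottom : ∀ {a v w x} → InDegZero E v → E v w → w ≢ b → v ≢ x → lookup S v < 4 →
                        f a ≡ move S v x → ∃[ m ] lookup (move S v x) w ≡ lookup (f b) w + 2 * m
  drained-into-bottom {a} {v} {w} v-source v→w w≢b v≢x Sv<4 fa =
    poor-source-Reachable oriented v-source fed-by-v
      (≤-trans (≤-reflexive (lookup-move-source S v≢x)) (∸-monoˡ-≤ 2 (≤-pred Sv<4)))
      (subst (λ X → Reachable E X (f b)) fa (gmap f edge⇒Move (reaches-bottom a)))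
    where
    fed-by-v : ∀ u → E u w → u ≡ v
    fed-by-v with out-edge-or-sink w
    ... | inj₁ (_ , w→y) = unique-in-neighbour v→w w→y
    ... | inj₂ w-sink    = ⊥-elim (w≢b (b-unique w w-sink))

  poor-split⇒⊥ : ∀ {a a′ v w w′} → E v w → E v w′ → w ≢ w′ → w ≢ b → lookup S v < 4 →
                 f a ≡ move S v w → f a′ ≡ move S v w′ → ⊥
  poor-split⇒⊥ {v = v} {w} {w′} v→w v→w′ w≢w′ w≢b Sv<4 fa fa′
    with drained-into-bottom (two-out⇒source v→w v→w′ w≢w′) v→w w≢b (edge⇒≢ v→w) Sv<4 fa
       | drained-into-bottom (two-out⇒source v→w v→w′ w≢w′) v→w w≢b (edge⇒≢ v→w′) Sv<4 fa′
  ... | m , wS₁≡ | m′ , wS₂≡ = parity-clash {y = lookup (f b) w} {m} {m′}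
    (trans (sym (lookup-move-target S (edge⇒≢ v→w))) wS₁≡)
    (trans (sym (lookup-move-other S (edge⇒≢ v→w′) (edge⇒≢ v→w) (≢-sym w≢w′))) wS₂≡)

  no-isomorphism : ⊥
  no-isomorphism with source⇒two-out s₀-source
  ... | a₁ , a₂ , a₁≢a₂ , s₀→a₁ , s₀→a₂ with Move-from-S s₀→a₁ | Move-from-S s₀→a₂
  ... | v₁ , w₁ , v₁→w₁ , 2≤Sv₁ , fa₁ | v₂ , w₂ , v₂→w₂ , 2≤Sv₂ , fa₂ with v₁ ≟ᶠ v₂
  ... | no v₁≢v₂ = <⇒≱ 4<k (commuting-moves⇒≤4 s₀→a₁ s₀→a₂ a₁≢a₂ v₁→w₁ v₂→w₂ fa₁ fa₂ 2≤Sv₁ 2≤Sv₂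
          (move-keeps-other-enabled S (edge⇒≢ v₁→w₁) v₁≢v₂ 2≤Sv₂)
          (move-keeps-other-enabled S (edge⇒≢ v₂→w₂) (≢-sym v₁≢v₂) 2≤Sv₁))
  ... | yes refl with w₁ ≟ᶠ w₂
  ...   | yes refl = a₁≢a₂ (f-injective a₁ a₂ (trans fa₁ (sym fa₂)))
  ...   | no w₁≢w₂ with 4 ≤? lookup S v₁
  ...     | yes 4≤Sv = <⇒≱ 4<k (commuting-moves⇒≤4 s₀→a₁ s₀→a₂ a₁≢a₂ v₁→w₁ v₂→w₂ fa₁ fa₂ 2≤Sv₁ 2≤Sv₂
                         (move-keeps-rich-source-enabled S (edge⇒≢ v₁→w₁) 4≤Sv)
                         (move-keeps-rich-source-enabled S (edge⇒≢ v₂→w₂) 4≤Sv))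
  ...     | no 4≰Sv with w₁ ≟ᶠ b
  ...       | no  w₁≢b = poor-split⇒⊥ v₁→w₁ v₂→w₂ w₁≢w₂ w₁≢b (≰⇒> 4≰Sv) fa₁ fa₂
  ...       | yes refl = poor-split⇒⊥ v₂→w₂ v₁→w₁ (≢-sym w₁≢w₂) (≢-sym w₁≢w₂) (≰⇒> 4≰Sv) fa₂ fa₁

theorem3p1 : (k : ℕ) → 4 < k → (E : Digraph k) → DownwardCycle E →
    (S : Assignment k) → ¬ IsoToAssignmentGraph E S
theorem3p1 k 4<k E (oriented , cycle , _ , _ , _ , b-unique) S (f , f-reachable , f-injective , f-surjective , edge⇔Move) =
  AssignmentGraphIso.no-isomorphism 4<k oriented cycle b-unique f f-reachable f-injective f-surjective edge⇔Move
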